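{- Let $\ell>1$ be an even integer. For all positive integers $n$, \[ b_{\ell}^e(n)-b_{\ell}^o(n)=(-1)^n d_{\ell}(n), \] where $b_{\ell}^e(n)$ (resp. $b_{\ell}^o(n)$) is the number of $\ell$-regular partitions of $n$ into an even (resp. odd) number of parts, and $d_{\ell}(n)$ is the number of partitions of $n$ into distinct parts each of which is congruent to one of $0,1,3,\dots,\ell-3,\ell-1$ modulo $\ell$.
   Context: A partition of a positive integer $n$ is a finite nonincreasing sequence of positive integers summing to $n$; its entries are its parts. For an integer $\ell>1$, a partition is called $\ell$-regular if none of its parts is divisible by $\ell$. -}

module Defs where

open import Data.Nat using (ℕ; zero; suc; _≥_; _≤_; _<_; _%_; NonZero)
open import Data.Nat.Divisibility using (_∣_)
open import Data.List using (List; []; _∷_; length)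
open import Data.Nat.ListAction using (sum)
open import Data.List.Relation.Unary.All using (All)
open import Data.List.Relation.Unary.Linked using (Linked)
open import Data.List.Relation.Unary.Unique.Propositional using (Unique)
open import Data.List.Membership.Propositional using (_∈_)
open import Data.Product using (_×_; ∃)
open import Data.Sum using (_⊎_)
open import Data.Integer using (ℤ; +_; _-_; _*_; -[1+_])
open import Function.Bundles using (_⇔_)
open import Relation.Binary.PropositionalEquality using (_≡_)
open import Relation.Nullary using (¬_)

IsPartition : ℕ → List ℕ → Set
IsPartition n λs = All (λ k → 1 ≤ k) λs × Linked _≥_ λs × sum λs ≡ n

Regular : ℕ → List ℕ → Set
Regular ℓ λs = All (λ k → ¬ (ℓ ∣ k)) λs

Even Odd : ℕ → Set
Even m = 2 ∣ m
Odd m = ¬ (2 ∣ m)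

DistinctParts : List ℕ → Set
DistinctParts λs = Linked (λ a b → a > b) λs
  where open Data.Nat using (_>_)

-- k is congruent to one of 0,1,3,...,ℓ-3,ℓ-1 modulo ℓ (ℓ even):
-- i.e. k mod ℓ is 0 or odd.
AllowedResidue : (ℓ : ℕ) → .{{NonZero ℓ}} → ℕ → Set
AllowedResidue ℓ k = (k % ℓ ≡ 0) ⊎ Odd (k % ℓ)

_Counts_ : ℕ → (List ℕ → Set) → Set
c Counts P = ∃ λ (L : List (List ℕ)) →
  Unique L × (∀ x → (x ∈ L) ⇔ P x) × length L ≡ c

sign : ℕ → ℤ
sign zero = + 1
sign (suc zero) = -[1+ 0 ]
sign (suc (suc n)) = sign n

BE BO : ℕ → ℕ → List ℕ → Set
BE ℓ n λs = IsPartition n λs × Regular ℓ λs × Even (length λs)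
BO ℓ n λs = IsPartition n λs × Regular ℓ λs × Odd (length λs)

D : (ℓ : ℕ) → .{{NonZero ℓ}} → ℕ → List ℕ → Set
D ℓ n λs = IsPartition n λs × DistinctParts λs × All (AllowedResidue ℓ) λs

-- The generating function of b^e_ℓ − b^o_ℓ is ∏_{ℓ ∤ k} (1 + q^k)⁻¹, each part k contributing −q^k,
-- and that of (−1)^n d_ℓ(n) is ∏_{k allowed} (1 + (−q)^k). Their ratio is 1: an odd k is both
-- ℓ-regular and allowed (ℓ is even) and contributes (1 + q^k)(1 − q^k), an even k contributes
-- a single factor 1 + q^k, from the regular side if ℓ ∤ k and from the allowed side if ℓ ∣ k.
-- So the claim is Euler's identity ∏_k (1 + q^k) ∏_{k odd} (1 − q^k) = 1. Everything is done
-- with power series truncated at degree n, where products of binomials 1 + c q^k (k ≥ 1) cancel.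

module Submission where

open import Defs
open import Data.Nat using (ℕ; zero; suc; _≤_; _<_; _≥_; _>_; _∸_; z≤n; s≤s; NonZero; _%_)
import Data.Nat as ℕ
import Data.Nat.Properties as ℕ
open import Data.Nat.Divisibility
  using (_∣_; _∣?_; divides; ∣-trans; ∣-refl; ∣m+n∣m⇒∣n; ∣⇒≤; n∣m⇒m%n≡0; m%n≡0⇒n∣m; ∣n∣m%n⇒∣m; %-presˡ-∣)
open import Data.Nat.ListAction using (sum)
open import Data.Integer using (ℤ; +_; -_; 0ℤ; 1ℤ; -1ℤ; _+_; _-_; _*_)
import Data.Integer.Properties as ℤ
open import Data.Integer.Tactic.RingSolver using (solve-∀)
open import Data.Product using (_×_; _,_; proj₁; proj₂; ∃)
open import Data.Sum using (inj₁; inj₂)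
open import Data.Empty using (⊥-elim)
open import Data.Bool using (Bool; true; false; not; _∧_)
open import Data.List using (List; []; _∷_; _++_; map; filter; length)
open import Data.List.Properties using (∷-injectiveʳ; ++-identityʳ)
open import Data.List.Relation.Unary.All as All using (All; []; _∷_)
open import Data.List.Relation.Unary.Any using (here; there)
open import Data.List.Relation.Unary.AllPairs using ([]; _∷_)
open import Data.List.Relation.Unary.Linked as Linked using (Linked; []; [-]; _∷_)
open import Data.List.Relation.Unary.Linked.Properties using (Linked⇒AllPairs)
open import Data.List.Relation.Unary.Unique.Propositional using (Unique)
import Data.List.Relation.Unary.Unique.Propositional.Properties as Unique
open import Data.List.Membership.Propositional using (_∈_)
open import Data.List.Membership.Propositional.Properties
  using (∈-map⁺; ∈-map⁻; ∈-++⁺ˡ; ∈-++⁺ʳ; ∈-++⁻; ∈-filter⁺; ∈-filter⁻)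
open import Data.List.Membership.Propositional.Properties.WithK using (unique∧set⇒bag)
open import Data.List.Relation.Binary.BagAndSetEquality using (∼bag⇒↭)
open import Data.List.Relation.Binary.Permutation.Propositional as ↭ using (_↭_; prep; swap)
open import Data.List.Relation.Binary.Permutation.Propositional.Properties using (↭-length) renaming (shift to ↭-shift)
open import Function.Bundles using (_⇔_; mk⇔; Equivalence)
open import Relation.Binary.Definitions using (Transitive)
open import Relation.Binary.PropositionalEquality
open import Relation.Nullary using (Dec; yes; no; does; ¬_; ¬?)
open import Relation.Nullary.Decidable using (_⊎-dec_; _×-dec_; dec-true; dec-false)
open import Relation.Unary using (Decidable)

Series : Set
Series = ℕ → ℤ

δ : Series
δ zero    = 1ℤ
δ (suc _) = 0ℤ

shift : ℕ → Series → Series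
shift zero    F n       = F n
shift (suc k) F zero    = 0ℤ
shift (suc k) F (suc n) = shift k F n

shift-shift : ∀ k j F → shift k (shift j F) ≗ shift (k ℕ.+ j) F
shift-shift zero    j F n       = refl
shift-shift (suc k) j F zero    = refl
shift-shift (suc k) j F (suc n) = shift-shift k j F n

shift-linear : ∀ k F G d → shift k (λ m → F m + d * G m) ≗ λ n → shift k F n + d * shift k G n
shift-linear zero    F G d n       = refl
shift-linear (suc k) F G d zero    = sym (trans (ℤ.+-identityˡ _) (ℤ.*-zeroʳ d))
shift-linear (suc k) F G d (suc n) = shift-linear k F G d n

shift-< : ∀ k F {n} → n < k → shift k F n ≡ 0ℤ
shift-< (suc k) F {zero}  _         = refl
shift-< (suc k) F {suc n} (s≤s n<k) = shift-< k F n<k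

shift-≥ : ∀ k F {n} → k ≤ n → shift k F n ≡ F (n ∸ k)
shift-≥ zero    F         _         = refl
shift-≥ (suc k) F {suc n} (s≤s k≤n) = shift-≥ k F k≤n

infix 4 _≈[_]_

_≈[_]_ : Series → ℕ → Series → Set
F ≈[ N ] G = ∀ n → n ≤ N → F n ≡ G n

≈-refl : ∀ {F} N → F ≈[ N ] F
≈-refl N n _ = refl

≈-sym : ∀ {F G} N → F ≈[ N ] G → G ≈[ N ] F
≈-sym N F≈G n n≤N = sym (F≈G n n≤N)

≈-trans : ∀ {F G H} N → F ≈[ N ] G → G ≈[ N ] H → F ≈[ N ] H
≈-trans N F≈G G≈H n n≤N = trans (F≈G n n≤N) (G≈H n n≤N)

≗⇒≈ : ∀ {F G} N → F ≗ G → F ≈[ N ] G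
≗⇒≈ N F≗G n _ = F≗G n

shift-cong : ∀ k {F G} N → F ≈[ N ] G → shift k F ≈[ N ] shift k G
shift-cong zero    N F≈G n       n≤N = F≈G n n≤N
shift-cong (suc k) N F≈G zero    _   = refl
shift-cong (suc k) {F} {G} N F≈G (suc n) n<N =
  shift-cong k {F} {G} n (λ m m≤n → F≈G m (ℕ.≤-trans m≤n (ℕ.<⇒≤ n<N))) n ℕ.≤-refl

Binomial : Set
Binomial = ℕ × ℤ

infixr 5 _⊛_

-- (k , c) ⊛ F is the product (1 + c q^k) F
_⊛_ : Binomial → Series → Series
((k , c) ⊛ F) n = F n + c * shift k F n

⊛-comm : ∀ f g F → f ⊛ g ⊛ F ≗ g ⊛ f ⊛ F
⊛-comm (k , c) (j , d) F n = begin
  (F n + d * shift j F n) + c * shift k (λ m → F m + d * shift j F m) n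
    ≡⟨ cong (λ t → (F n + d * shift j F n) + c * t) (expand k j d) ⟩
  (F n + d * shift j F n) + c * (shift k F n + d * shift (k ℕ.+ j) F n)
    ≡⟨ cong (λ t → (F n + d * shift j F n) + c * (shift k F n + d * shift t F n)) (ℕ.+-comm k j) ⟩
  (F n + d * shift j F n) + c * (shift k F n + d * shift (j ℕ.+ k) F n)
    ≡⟨ exchange (F n) (shift j F n) (shift k F n) (shift (j ℕ.+ k) F n) c d ⟩
  (F n + c * shift k F n) + d * (shift j F n + c * shift (j ℕ.+ k) F n)
    ≡⟨ cong (λ t → (F n + c * shift k F n) + d * t) (sym (expand j k c)) ⟩
  (F n + c * shift k F n) + d * shift j (λ m → F m + c * shift k F m) n ∎
  where
  open ≡-Reasoning
  expand : ∀ k j d → shift k (λ m → F m + d * shift j F m) n ≡ shift k F n + d * shift (k ℕ.+ j) F n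
  expand k j d = trans (shift-linear k F (shift j F) d n) (cong (λ t → shift k F n + d * t) (shift-shift k j F n))
  exchange : ∀ a b e f c d → (a + d * b) + c * (e + d * f) ≡ (a + c * e) + d * (b + c * f)
  exchange = solve-∀

⊛-cong : ∀ f {F G} N → F ≈[ N ] G → f ⊛ F ≈[ N ] f ⊛ G
⊛-cong (k , c) {F} {G} N F≈G n n≤N = cong₂ (λ x y → x + c * y) (F≈G n n≤N) (shift-cong k {F} {G} N F≈G n n≤N)

⊛-high : ∀ {k} c F {N} → N < k → (k , c) ⊛ F ≈[ N ] F
⊛-high {k} c F N<k n n≤N = begin
  F n + c * shift k F n ≡⟨ cong (λ t → F n + c * t) (shift-< k F (ℕ.≤-<-trans n≤N N<k)) ⟩
  F n + c * 0ℤ         ≡⟨ cong (λ t → F n + t) (ℤ.*-zeroʳ c) ⟩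
  F n + 0ℤ             ≡⟨ ℤ.+-identityʳ (F n) ⟩
  F n                  ∎
  where open ≡-Reasoning

⊛-zero : ∀ k F → (k , 0ℤ) ⊛ F ≗ F
⊛-zero k F n = ℤ.+-identityʳ (F n)

⊛-conjugates : ∀ k F → (k , 1ℤ) ⊛ (k , -1ℤ) ⊛ F ≗ (k ℕ.+ k , -1ℤ) ⊛ F
⊛-conjugates k F n = begin
  (F n + -1ℤ * shift k F n) + 1ℤ * shift k (λ m → F m + -1ℤ * shift k F m) n
    ≡⟨ cong (λ t → (F n + -1ℤ * shift k F n) + 1ℤ * t) (shift-linear k F (shift k F) -1ℤ n) ⟩
  (F n + -1ℤ * shift k F n) + 1ℤ * (shift k F n + -1ℤ * shift k (shift k F) n)
    ≡⟨ cong (λ t → (F n + -1ℤ * shift k F n) + 1ℤ * (shift k F n + -1ℤ * t)) (shift-shift k k F n) ⟩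
  (F n + -1ℤ * shift k F n) + 1ℤ * (shift k F n + -1ℤ * shift (k ℕ.+ k) F n)
    ≡⟨ telescope (F n) (shift k F n) (shift (k ℕ.+ k) F n) ⟩
  F n + -1ℤ * shift (k ℕ.+ k) F n ∎
  where
  open ≡-Reasoning
  telescope : ∀ a b e → (a + -1ℤ * b) + 1ℤ * (b + -1ℤ * e) ≡ a + -1ℤ * e
  telescope = solve-∀

+-cancelʳ : ∀ a b x → a + x ≡ b + x → a ≡ b
+-cancelʳ a b x a+x≡b+x = begin
  a             ≡⟨ add-sub a x ⟩
  (a + x) + - x ≡⟨ cong (λ t → t + - x) a+x≡b+x ⟩
  (b + x) + - x ≡⟨ sym (add-sub b x) ⟩
  b             ∎
  where
  open ≡-Reasoning
  add-sub : ∀ a x → a ≡ (a + x) + - x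
  add-sub = solve-∀

-- Coefficient n of (1 + c q^(k+1)) F is F n plus a combination of lower coefficients of F.
⊛-cancel : ∀ k c {F G} N → (suc k , c) ⊛ F ≈[ N ] (suc k , c) ⊛ G → F ≈[ N ] G
⊛-cancel k c {F} {G} N eq n n≤N = below n n≤N n ℕ.≤-refl
  where
  below : ∀ n → n ≤ N → ∀ m → m ≤ n → F m ≡ G m
  below zero    _   zero z≤n = +-cancelʳ (F 0) (G 0) (c * 0ℤ) (eq 0 z≤n)
  below (suc n) n<N m m≤n with ℕ.m≤n⇒m<n∨m≡n m≤n
  ... | inj₁ (s≤s m≤n′) = below n (ℕ.<⇒≤ n<N) m m≤n′
  ... | inj₂ refl = +-cancelʳ (F (suc n)) (G (suc n)) (c * shift k F n)
        (trans (eq (suc n) n<N) (cong (λ t → G (suc n) + c * t)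
          (sym (shift-cong k {F} {G} n (below n (ℕ.<⇒≤ n<N)) n ℕ.≤-refl))))

prod : List Binomial → Series → Series
prod []       F = F
prod (f ∷ fs) F = f ⊛ prod fs F

prod-cong : ∀ fs {F G} N → F ≈[ N ] G → prod fs F ≈[ N ] prod fs G
prod-cong []       N F≈G = F≈G
prod-cong (f ∷ fs) N F≈G = ⊛-cong f N (prod-cong fs N F≈G)

prod-++ : ∀ fs gs F → prod (fs ++ gs) F ≡ prod fs (prod gs F)
prod-++ []       gs F = refl
prod-++ (f ∷ fs) gs F = cong (f ⊛_) (prod-++ fs gs F)

prod-↭ : ∀ {fs gs} → fs ↭ gs → ∀ F N → prod fs F ≈[ N ] prod gs F
prod-↭ ↭.refl             F N = ≈-refl N
prod-↭ (prep f p)         F N = ⊛-cong f N (prod-↭ p F N)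
prod-↭ (swap {fs} f g p)  F N =
  ≈-trans N (≗⇒≈ N (⊛-comm f g (prod fs F))) (⊛-cong g N (⊛-cong f N (prod-↭ p F N)))
prod-↭ (↭.trans p q)      F N = ≈-trans N (prod-↭ p F N) (prod-↭ q F N)

⊛-prod : ∀ f gs G N → f ⊛ prod gs G ≈[ N ] prod gs (f ⊛ G)
⊛-prod f []       G N = ≈-refl N
⊛-prod f (g ∷ gs) G N = ≈-trans N (≗⇒≈ N (⊛-comm f g (prod gs G))) (⊛-cong g N (⊛-prod f gs G N))

prod-cancel : ∀ fs {F G} N → All (λ f → 1 ≤ proj₁ f) fs → prod fs F ≈[ N ] prod fs G → F ≈[ N ] G
prod-cancel []                 N []              eq = eq
prod-cancel ((suc k , c) ∷ fs) N (s≤s z≤n ∷ pos) eq = prod-cancel fs N pos (⊛-cancel k c N eq)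

infix 4 _≋_

record _≋_ (fs gs : List Binomial) : Set where
  constructor mk≋
  field same-prod : ∀ F N → prod fs F ≈[ N ] prod gs F
open _≋_

≋-refl : ∀ {fs} → fs ≋ fs
≋-refl = mk≋ λ F N → ≈-refl N

≋-trans : ∀ {fs gs hs} → fs ≋ gs → gs ≋ hs → fs ≋ hs
≋-trans p q = mk≋ λ F N → ≈-trans N (same-prod p F N) (same-prod q F N)

↭⇒≋ : ∀ {fs gs} → fs ↭ gs → fs ≋ gs
↭⇒≋ p = mk≋ (prod-↭ p)

≋-++ : ∀ {fs gs hs ks} → fs ≋ gs → hs ≋ ks → fs ++ hs ≋ gs ++ ks
≋-++ {fs} {gs} {hs} {ks} p q = mk≋ λ F N →
  subst₂ (λ u v → u ≈[ N ] v) (sym (prod-++ fs hs F)) (sym (prod-++ gs ks F))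
    (≈-trans N (prod-cong fs N (same-prod q F N)) (same-prod p (prod ks F) N))

≋-prefix : ∀ fs {gs hs} → gs ≋ hs → fs ++ gs ≋ fs ++ hs
≋-prefix fs = ≋-++ {fs} {fs} ≋-refl

≋-coeff : ∀ k {c c′} fs → c ≡ c′ → (k , c) ∷ fs ≋ (k , c′) ∷ fs
≋-coeff k fs refl = ≋-refl

≋-zero : ∀ k fs → (k , 0ℤ) ∷ fs ≋ fs
≋-zero k fs = mk≋ λ F N → ≗⇒≈ N (⊛-zero k (prod fs F))

≋-conjugates : ∀ k fs → (k , 1ℤ) ∷ (k , -1ℤ) ∷ fs ≋ (k ℕ.+ k , -1ℤ) ∷ fs
≋-conjugates k fs = mk≋ λ F N → ≗⇒≈ N (⊛-conjugates k (prod fs F))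

binomials : (ℕ → ℤ) → ℕ → List Binomial
binomials a zero    = []
binomials a (suc k) = (suc k , a (suc k)) ∷ binomials a k

binomials-positive : ∀ a N → All (λ f → 1 ≤ proj₁ f) (binomials a N)
binomials-positive a zero    = []
binomials-positive a (suc N) = s≤s z≤n ∷ binomials-positive a N

binomialPairs : (ℕ → ℤ) → (ℕ → ℤ) → ℕ → List Binomial
binomialPairs a b zero    = []
binomialPairs a b (suc k) = (suc k , a (suc k)) ∷ (suc k , b (suc k)) ∷ binomialPairs a b k

binomials-++-↭ : ∀ a b N → binomials a N ++ binomials b N ↭ binomialPairs a b N
binomials-++-↭ a b zero    = ↭.refl
binomials-++-↭ a b (suc N) =
  prep _ (↭.trans (↭-shift _ (binomials a N) (binomials b N)) (prep _ (binomials-++-↭ a b N)))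

binomialPairs-≋ : ∀ {a b a′ b′} →
  (∀ k fs → (k , a k) ∷ (k , b k) ∷ fs ≋ (k , a′ k) ∷ (k , b′ k) ∷ fs) →
  ∀ N → binomialPairs a b N ≋ binomialPairs a′ b′ N
binomialPairs-≋ same zero    = ≋-refl
binomialPairs-≋ {a′ = a′} {b′} same (suc N) =
  ≋-trans (same (suc N) _) (≋-prefix ((suc N , a′ (suc N)) ∷ (suc N , b′ (suc N)) ∷ []) (binomialPairs-≋ same N))

-- Euler's identity ∏ (1 + q^k) ∏_{k odd} (1 - q^k) = 1, up to any degree

double : ℕ → ℕ
double zero    = zero
double (suc j) = suc (suc (double j))

double-≡-+ : ∀ j → double j ≡ j ℕ.+ j
double-≡-+ zero    = refl
double-≡-+ (suc j) = cong suc (trans (cong suc (double-≡-+ j)) (sym (ℕ.+-suc j j)))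

double-mono : ∀ {i j} → i ≤ j → double i ≤ double j
double-mono z≤n       = z≤n
double-mono (s≤s i≤j) = s≤s (s≤s (double-mono i≤j))

n≤double : ∀ j → j ≤ double j
n≤double zero    = z≤n
n≤double (suc j) = s≤s (ℕ.m≤n⇒m≤1+n (n≤double j))

data EvenOdd : ℕ → Set where
  even : ∀ j → EvenOdd (double j)
  odd  : ∀ j → EvenOdd (suc (double j))

evenOdd : ∀ n → EvenOdd n
evenOdd zero = even 0
evenOdd (suc n) with evenOdd n
... | even j = odd j
... | odd j  = even (suc j)

oddCoeff evenCoeff : ℕ → ℤ
oddCoeff zero          = 0ℤ
oddCoeff (suc zero)    = -1ℤ
oddCoeff (suc (suc k)) = oddCoeff k
evenCoeff zero          = -1ℤ
evenCoeff (suc zero)    = 0ℤ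
evenCoeff (suc (suc k)) = evenCoeff k

oddCoeff-even : ∀ j → oddCoeff (double j) ≡ 0ℤ
oddCoeff-even zero    = refl
oddCoeff-even (suc j) = oddCoeff-even j

oddCoeff-odd : ∀ j → oddCoeff (suc (double j)) ≡ -1ℤ
oddCoeff-odd zero    = refl
oddCoeff-odd (suc j) = oddCoeff-odd j

evenCoeff-even : ∀ j → evenCoeff (double j) ≡ -1ℤ
evenCoeff-even zero    = refl
evenCoeff-even (suc j) = evenCoeff-even j

evenCoeff-odd : ∀ j → evenCoeff (suc (double j)) ≡ 0ℤ
evenCoeff-odd zero    = refl
evenCoeff-odd (suc j) = evenCoeff-odd j

eulerProduct : ℕ → List Binomial
eulerProduct = binomialPairs (λ _ → 1ℤ) oddCoeff

evenSquares : ℕ → List Binomial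
evenSquares zero    = []
evenSquares (suc j) = (double (suc j) , -1ℤ) ∷ evenSquares j

-- For each k, exactly one of the factors 1 + evenCoeff k q^k, 1 + oddCoeff k q^k is 1 - q^k.
completeToConjugates : ∀ k fs → (k , evenCoeff k) ∷ (k , 1ℤ) ∷ (k , oddCoeff k) ∷ fs ≋ (k , 1ℤ) ∷ (k , -1ℤ) ∷ fs
completeToConjugates k fs with evenOdd k
... | even j = ≋-trans (≋-coeff _ _ (evenCoeff-even j))
                (≋-trans (↭⇒≋ (swap _ _ ↭.refl))
                  (≋-prefix (_ ∷ _ ∷ []) (≋-trans (≋-coeff _ fs (oddCoeff-even j)) (≋-zero _ fs))))
... | odd j  = ≋-trans (≋-coeff _ _ (evenCoeff-odd j))
                (≋-trans (≋-zero _ _) (≋-prefix (_ ∷ []) (≋-coeff _ fs (oddCoeff-odd j))))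

evenBinomials++eulerProduct≋evenSquares : ∀ N → binomials evenCoeff N ++ eulerProduct N ≋ evenSquares N
evenBinomials++eulerProduct≋evenSquares zero    = ≋-refl
evenBinomials++eulerProduct≋evenSquares (suc N) =
  ≋-trans (↭⇒≋ (prep _ (↭.trans (↭-shift _ (binomials evenCoeff N) _) (prep _ (↭-shift _ (binomials evenCoeff N) _)))))
    (≋-trans (completeToConjugates k (binomials evenCoeff N ++ eulerProduct N))
      (≋-trans (≋-conjugates k _)
        (subst (λ t → (t , -1ℤ) ∷ binomials evenCoeff N ++ eulerProduct N ≋ evenSquares k) (double-≡-+ k)
          (≋-prefix ((double k , -1ℤ) ∷ []) (evenBinomials++eulerProduct≋evenSquares N)))))
  where k = suc N

evenBinomials≋evenSquares : ∀ j →
  binomials evenCoeff (double j) ≋ evenSquares j × binomials evenCoeff (suc (double j)) ≋ evenSquares j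
evenBinomials≋evenSquares zero    = ≋-refl , ≋-zero 1 []
evenBinomials≋evenSquares (suc j) = atEven , ≋-trans (≋-coeff _ _ (evenCoeff-odd (suc j))) (≋-trans (≋-zero _ _) atEven)
  where
  atEven : binomials evenCoeff (double (suc j)) ≋ evenSquares (suc j)
  atEven = ≋-trans (≋-coeff _ _ (evenCoeff-even (suc j)))
    (≋-prefix ((double (suc j) , -1ℤ) ∷ [])
      (≋-trans (≋-coeff _ _ (evenCoeff-odd j)) (≋-trans (≋-zero _ _) (proj₁ (evenBinomials≋evenSquares j)))))

evenSquares-truncate : ∀ {j M N} F → j ≤ M → N < double (suc j) → prod (evenSquares M) F ≈[ N ] prod (evenSquares j) F
evenSquares-truncate {j} {M} {N} F j≤M N<2j+2 with ℕ.m≤n⇒m<n∨m≡n j≤M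
... | inj₂ refl = ≈-refl N
evenSquares-truncate {j} {suc M} {N} F _ N<2j+2 | inj₁ (s≤s j≤M) =
  ≈-trans N (⊛-high -1ℤ (prod (evenSquares M) F) (ℕ.<-≤-trans N<2j+2 (double-mono (s≤s j≤M))))
    (evenSquares-truncate F j≤M N<2j+2)

-- Multiplying by the even binomials turns eulerProduct N into evenSquares N; up to degree N both
-- the even binomials and evenSquares N reduce to evenSquares ⌊N/2⌋, which then cancels.
euler-truncated : ∀ {N j} F → binomials evenCoeff N ≋ evenSquares j → j ≤ N → N < double (suc j) →
  prod (eulerProduct N) F ≈[ N ] F
euler-truncated {N} {j} F evens≋squares j≤N N<2j+2 =
  prod-cancel evens N (binomials-positive evenCoeff N)
    (subst (λ G → G ≈[ N ] prod evens F) (prod-++ evens (eulerProduct N) F)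
      (≈-trans N (same-prod (evenBinomials++eulerProduct≋evenSquares N) F N)
        (≈-trans N (evenSquares-truncate F j≤N N<2j+2) (≈-sym N (same-prod evens≋squares F N)))))
  where evens = binomials evenCoeff N

euler : ∀ N F → prod (eulerProduct N) F ≈[ N ] F
euler N F with evenOdd N
... | even j = euler-truncated F (proj₁ (evenBinomials≋evenSquares j)) (n≤double j) (ℕ.m≤n⇒m≤1+n (ℕ.n<1+n _))
... | odd j  = euler-truncated F (proj₂ (evenBinomials≋evenSquares j)) (ℕ.m≤n⇒m≤1+n (n≤double j)) ℕ.≤-refl

-- Enumerations of partitions

≥-trans : Transitive _≥_
≥-trans j≤i k≤j = ℕ.≤-trans k≤j j≤i

>-trans : Transitive _>_
>-trans j<i k<j = ℕ.<-trans k<j j<i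

linked-head : ∀ {R : ℕ → ℕ → Set} → Transitive R → ∀ {k y} → Linked R (k ∷ y) → All (R k) y
linked-head trans l with Linked⇒AllPairs trans l
... | Rky ∷ _ = Rky

All⇒Linked-∷ : ∀ {R : ℕ → ℕ → Set} {k y} → All (R k) y → Linked R y → Linked R (k ∷ y)
All⇒Linked-∷ []        []  = [-]
All⇒Linked-∷ (Rky ∷ _) Ry  = Rky ∷ Ry

positive-sum≡0 : ∀ {x} → All (1 ≤_) x → sum x ≡ 0 → x ≡ []
positive-sum≡0 []              _  = refl
positive-sum≡0 (s≤s z≤n ∷ _)   ()

parts≤sum : ∀ x → All (_≤ sum x) x
parts≤sum []      = []
parts≤sum (k ∷ x) = ℕ.m≤m+n k (sum x) ∷ All.map (λ p → ℕ.≤-trans p (ℕ.m≤n+m (sum x) k)) (parts≤sum x)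

parts≤n : ∀ {n x} → IsPartition n x → All (_≤ n) x
parts≤n {x = x} (_ , _ , refl) = parts≤sum x

All-≤-suc : ∀ {m y} → All (_≤ m) y → All (_≤ suc m) y
All-≤-suc = All.map ℕ.m≤n⇒m≤1+n

sum-tail : ∀ k y {n} → k ℕ.+ sum y ≡ n → sum y ≡ n ∸ k
sum-tail k y refl = sym (ℕ.m+n∸m≡n k (sum y))

BoundedPartition : ℕ → ℕ → List ℕ → Set
BoundedPartition m n x = IsPartition n x × All (_≤ m) x

BoundedDistinctPartition : ℕ → ℕ → List ℕ → Set
BoundedDistinctPartition m n x = IsPartition n x × DistinctParts x × All (_≤ m) x

-- The partitions of n with parts ≤ m, listed by their largest part; f is recursion fuel,
-- sufficient as soon as n ≤ f.
mutual
  boundedPartitions : ℕ → ℕ → ℕ → List (List ℕ)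
  boundedPartitions f       m       zero    = [] ∷ []
  boundedPartitions f       zero    (suc n) = []
  boundedPartitions zero    (suc m) (suc n) = []
  boundedPartitions (suc f) (suc m) (suc n) =
    boundedPartitions (suc f) m (suc n) ++ withLargestPart f m n (m ℕ.≤? n)

  -- the partitions of suc n with largest part suc m
  withLargestPart : ∀ f m n → Dec (m ≤ n) → List (List ℕ)
  withLargestPart f m n (yes _) = map (suc m ∷_) (boundedPartitions f (suc m) (n ∸ m))
  withLargestPart f m n (no _)  = []

mutual
  ∈boundedPartitions⇒ : ∀ f m n x → x ∈ boundedPartitions f m n → BoundedPartition m n x
  ∈boundedPartitions⇒ f       m       zero    .[] (here refl) = ([] , [] , refl) , []
  ∈boundedPartitions⇒ (suc f) (suc m) (suc n) x   x∈ with ∈-++⁻ (boundedPartitions (suc f) m (suc n)) x∈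
  ... | inj₁ x∈′ = let (p , x≤m) = ∈boundedPartitions⇒ (suc f) m (suc n) x x∈′ in p , All-≤-suc x≤m
  ... | inj₂ x∈′ = ∈withLargestPart⇒ f m n (m ℕ.≤? n) x x∈′

  ∈withLargestPart⇒ : ∀ f m n d x → x ∈ withLargestPart f m n d → BoundedPartition (suc m) (suc n) x
  ∈withLargestPart⇒ f m n (yes m≤n) x x∈ with ∈-map⁻ (suc m ∷_) x∈
  ... | y , y∈ , refl with ∈boundedPartitions⇒ f (suc m) (n ∸ m) y y∈
  ... | (pos , dec , Σy) , y≤ =
    (s≤s z≤n ∷ pos , All⇒Linked-∷ y≤ dec , cong suc (trans (cong (m ℕ.+_) Σy) (ℕ.m+[n∸m]≡n m≤n))) ,
    ℕ.≤-refl ∷ y≤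

withLargestPart-head : ∀ f m n d x → x ∈ withLargestPart f m n d → ∃ λ y → x ≡ suc m ∷ y
withLargestPart-head f m n (yes _) x x∈ with ∈-map⁻ (suc m ∷_) x∈
... | y , _ , x≡ = y , x≡

mutual
  ∈boundedPartitions⇐ : ∀ f m n x → n ≤ f → BoundedPartition m n x → x ∈ boundedPartitions f m n
  ∈boundedPartitions⇐ f m zero x _ ((pos , _ , Σx) , _) with positive-sum≡0 pos Σx
  ... | refl = here refl
  ∈boundedPartitions⇐ f       zero    (suc n) []      _ ((_ , _ , ()) , _)
  ∈boundedPartitions⇐ f       zero    (suc n) (k ∷ y) _ ((s≤s z≤n ∷ _ , _) , () ∷ _)
  ∈boundedPartitions⇐ (suc f) (suc m) (suc n) []      _ ((_ , _ , ()) , _)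
  ∈boundedPartitions⇐ (suc f) (suc m) (suc n) (k ∷ y) n<f (p@(_ , dec , _) , k≤ ∷ _) with ℕ.m≤n⇒m<n∨m≡n k≤
  ... | inj₁ (s≤s k≤m) = ∈-++⁺ˡ (∈boundedPartitions⇐ (suc f) m (suc n) (k ∷ y) n<f
          (p , k≤m ∷ All.map (λ q → ℕ.≤-trans q k≤m) (linked-head ≥-trans dec)))
  ... | inj₂ refl = ∈-++⁺ʳ (boundedPartitions (suc f) m (suc n))
          (∈withLargestPart⇐ f m n (m ℕ.≤? n) y (ℕ.≤-pred n<f) p)

  ∈withLargestPart⇐ : ∀ f m n d y → n ≤ f → IsPartition (suc n) (suc m ∷ y) → suc m ∷ y ∈ withLargestPart f m n d
  ∈withLargestPart⇐ f m n (yes m≤n) y n≤f (_ ∷ pos , dec , Σ) =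
    ∈-map⁺ (suc m ∷_) (∈boundedPartitions⇐ f (suc m) (n ∸ m) y (ℕ.≤-trans (ℕ.m∸n≤m n m) n≤f)
      ((pos , Linked.tail dec , sum-tail m y (ℕ.suc-injective Σ)) , linked-head ≥-trans dec))
  ∈withLargestPart⇐ f m n (no m≰n) y _ (_ , _ , Σ) =
    ⊥-elim (m≰n (subst (m ≤_) (ℕ.suc-injective Σ) (ℕ.m≤m+n m (sum y))))

mutual
  boundedPartitions-unique : ∀ f m n → Unique (boundedPartitions f m n)
  boundedPartitions-unique f       m       zero    = [] ∷ []
  boundedPartitions-unique f       zero    (suc n) = []
  boundedPartitions-unique zero    (suc m) (suc n) = []
  boundedPartitions-unique (suc f) (suc m) (suc n) =
    Unique.++⁺ (boundedPartitions-unique (suc f) m (suc n)) (withLargestPart-unique f m n (m ℕ.≤? n)) disjoint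
    where
    disjoint : ∀ {x} → ¬ (x ∈ boundedPartitions (suc f) m (suc n) × x ∈ withLargestPart f m n (m ℕ.≤? n))
    disjoint {x} (x∈ , x∈′) with withLargestPart-head f m n (m ℕ.≤? n) x x∈′
    ... | y , refl with proj₂ (∈boundedPartitions⇒ (suc f) m (suc n) x x∈)
    ... | m<m ∷ _ = ℕ.<-irrefl refl m<m

  withLargestPart-unique : ∀ f m n d → Unique (withLargestPart f m n d)
  withLargestPart-unique f m n (yes _) = Unique.map⁺ ∷-injectiveʳ (boundedPartitions-unique f (suc m) (n ∸ m))
  withLargestPart-unique f m n (no _)  = []

boundedPartitions-suc-fuel : ∀ f m n → n ≤ f → boundedPartitions f m n ≡ boundedPartitions (suc f) m n
boundedPartitions-suc-fuel f       m       zero    _   = refl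
boundedPartitions-suc-fuel f       zero    (suc n) _   = refl
boundedPartitions-suc-fuel (suc f) (suc m) (suc n) n<f =
  cong₂ _++_ (boundedPartitions-suc-fuel (suc f) m (suc n) n<f) (withLargestPart-suc-fuel (m ℕ.≤? n))
  where
  withLargestPart-suc-fuel : ∀ d → withLargestPart f m n d ≡ withLargestPart (suc f) m n d
  withLargestPart-suc-fuel (yes _) = cong (map (suc m ∷_))
    (boundedPartitions-suc-fuel f (suc m) (n ∸ m) (ℕ.≤-trans (ℕ.m∸n≤m n m) (ℕ.≤-pred n<f)))
  withLargestPart-suc-fuel (no _)  = refl

boundedPartitions-fuel : ∀ f m n → n ≤ f → boundedPartitions f m n ≡ boundedPartitions n m n
boundedPartitions-fuel f m n n≤f with ℕ.m≤n⇒m<n∨m≡n n≤f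
... | inj₂ refl = refl
boundedPartitions-fuel (suc f) m n _ | inj₁ (s≤s n≤f) =
  trans (sym (boundedPartitions-suc-fuel f m n n≤f)) (boundedPartitions-fuel f m n n≤f)

mutual
  distinctPartitions : ℕ → ℕ → List (List ℕ)
  distinctPartitions zero    zero    = [] ∷ []
  distinctPartitions zero    (suc n) = []
  distinctPartitions (suc m) n       = distinctPartitions m n ++ withLargestDistinctPart m n (suc m ℕ.≤? n)

  -- the partitions of n into distinct parts with largest part suc m
  withLargestDistinctPart : ∀ m n → Dec (suc m ≤ n) → List (List ℕ)
  withLargestDistinctPart m n (yes _) = map (suc m ∷_) (distinctPartitions m (n ∸ suc m))
  withLargestDistinctPart m n (no _)  = []

mutual
  ∈distinctPartitions⇒ : ∀ m n x → x ∈ distinctPartitions m n → BoundedDistinctPartition m n x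
  ∈distinctPartitions⇒ zero    zero .[] (here refl) = ([] , [] , refl) , [] , []
  ∈distinctPartitions⇒ (suc m) n    x   x∈ with ∈-++⁻ (distinctPartitions m n) x∈
  ... | inj₁ x∈′ = let (p , dist , x≤m) = ∈distinctPartitions⇒ m n x x∈′ in p , dist , All-≤-suc x≤m
  ... | inj₂ x∈′ = ∈withLargestDistinctPart⇒ m n (suc m ℕ.≤? n) x x∈′

  ∈withLargestDistinctPart⇒ : ∀ m n d x → x ∈ withLargestDistinctPart m n d → BoundedDistinctPartition (suc m) n x
  ∈withLargestDistinctPart⇒ m n (yes m<n) x x∈ with ∈-map⁻ (suc m ∷_) x∈
  ... | y , y∈ , refl with ∈distinctPartitions⇒ m (n ∸ suc m) y y∈
  ... | (pos , dec , Σy) , dist , y≤m =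
    (s≤s z≤n ∷ pos , All⇒Linked-∷ (All-≤-suc y≤m) (Linked.map ℕ.<⇒≤ dist) ,
      trans (cong (suc m ℕ.+_) Σy) (ℕ.m+[n∸m]≡n m<n)) ,
    All⇒Linked-∷ (All.map s≤s y≤m) dist , ℕ.≤-refl ∷ All-≤-suc y≤m

withLargestDistinctPart-head : ∀ m n d x → x ∈ withLargestDistinctPart m n d → ∃ λ y → x ≡ suc m ∷ y
withLargestDistinctPart-head m n (yes _) x x∈ with ∈-map⁻ (suc m ∷_) x∈
... | y , _ , x≡ = y , x≡

mutual
  ∈distinctPartitions⇐ : ∀ m n x → BoundedDistinctPartition m n x → x ∈ distinctPartitions m n
  ∈distinctPartitions⇐ zero zero x ((pos , _ , Σx) , _) with positive-sum≡0 pos Σx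
  ... | refl = here refl
  ∈distinctPartitions⇐ zero    (suc n) []      ((_ , _ , ()) , _)
  ∈distinctPartitions⇐ zero    (suc n) (k ∷ y) ((s≤s z≤n ∷ _ , _) , _ , () ∷ _)
  ∈distinctPartitions⇐ (suc m) n       []      (p , dist , _) = ∈-++⁺ˡ (∈distinctPartitions⇐ m n [] (p , dist , []))
  ∈distinctPartitions⇐ (suc m) n       (k ∷ y) (p , dist , k≤ ∷ _) with ℕ.m≤n⇒m<n∨m≡n k≤
  ... | inj₁ (s≤s k≤m) = ∈-++⁺ˡ (∈distinctPartitions⇐ m n (k ∷ y)
          (p , dist , k≤m ∷ All.map (λ q → ℕ.≤-trans (ℕ.<⇒≤ q) k≤m) (linked-head >-trans dist)))
  ... | inj₂ refl = ∈-++⁺ʳ (distinctPartitions m n) (∈withLargestDistinctPart⇐ m n (suc m ℕ.≤? n) y p dist)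

  ∈withLargestDistinctPart⇐ : ∀ m n d y → IsPartition n (suc m ∷ y) → DistinctParts (suc m ∷ y) →
    suc m ∷ y ∈ withLargestDistinctPart m n d
  ∈withLargestDistinctPart⇐ m n (yes _) y (_ ∷ pos , dec , Σ) dist =
    ∈-map⁺ (suc m ∷_) (∈distinctPartitions⇐ m (n ∸ suc m) y
      ((pos , Linked.tail dec , sum-tail (suc m) y Σ) , Linked.tail dist ,
       All.map ℕ.≤-pred (linked-head >-trans dist)))
  ∈withLargestDistinctPart⇐ m n (no m≮n) y (_ , _ , Σ) _ =
    ⊥-elim (m≮n (subst (suc m ≤_) Σ (ℕ.m≤m+n (suc m) (sum y))))

mutual
  distinctPartitions-unique : ∀ m n → Unique (distinctPartitions m n)
  distinctPartitions-unique zero    zero    = [] ∷ []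
  distinctPartitions-unique zero    (suc n) = []
  distinctPartitions-unique (suc m) n       =
    Unique.++⁺ (distinctPartitions-unique m n) (withLargestDistinctPart-unique m n (suc m ℕ.≤? n)) disjoint
    where
    disjoint : ∀ {x} → ¬ (x ∈ distinctPartitions m n × x ∈ withLargestDistinctPart m n (suc m ℕ.≤? n))
    disjoint {x} (x∈ , x∈′) with withLargestDistinctPart-head m n (suc m ℕ.≤? n) x x∈′
    ... | y , refl with proj₂ (proj₂ (∈distinctPartitions⇒ m n x x∈))
    ... | m<m ∷ _ = ℕ.<-irrefl refl m<m

  withLargestDistinctPart-unique : ∀ m n d → Unique (withLargestDistinctPart m n d)
  withLargestDistinctPart-unique m n (yes _) = Unique.map⁺ ∷-injectiveʳ (distinctPartitions-unique m (n ∸ suc m))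
  withLargestDistinctPart-unique m n (no _)  = []

∈boundedPartitions⇔ : ∀ n x → x ∈ boundedPartitions n n n ⇔ IsPartition n x
∈boundedPartitions⇔ n x = mk⇔ (λ x∈ → proj₁ (∈boundedPartitions⇒ n n n x x∈))
  (λ p → ∈boundedPartitions⇐ n n n x ℕ.≤-refl (p , parts≤n p))

∈distinctPartitions⇔ : ∀ n x → x ∈ distinctPartitions n n ⇔ (IsPartition n x × DistinctParts x)
∈distinctPartitions⇔ n x = mk⇔ (λ x∈ → let (p , dist , _) = ∈distinctPartitions⇒ n n x x∈ in p , dist)
  (λ (p , dist) → ∈distinctPartitions⇐ n n x (p , dist , parts≤n p))

sumBy : (List ℕ → ℤ) → List (List ℕ) → ℤ
sumBy w []      = 0ℤ
sumBy w (x ∷ L) = w x + sumBy w L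

sumBy-++ : ∀ w L M → sumBy w (L ++ M) ≡ sumBy w L + sumBy w M
sumBy-++ w []      M = sym (ℤ.+-identityˡ _)
sumBy-++ w (x ∷ L) M = trans (cong (λ t → w x + t) (sumBy-++ w L M)) (sym (ℤ.+-assoc (w x) _ _))

sumBy-*ˡ : ∀ c w L → sumBy (λ x → c * w x) L ≡ c * sumBy w L
sumBy-*ˡ c w []      = sym (ℤ.*-zeroʳ c)
sumBy-*ˡ c w (x ∷ L) = trans (cong (λ t → c * w x + t) (sumBy-*ˡ c w L)) (sym (ℤ.*-distribˡ-+ c (w x) _))

sumBy-minus : ∀ v w L → sumBy v L - sumBy w L ≡ sumBy (λ x → v x - w x) L
sumBy-minus v w []      = refl
sumBy-minus v w (x ∷ L) = trans (interchange (v x) (w x) (sumBy v L) (sumBy w L)) (cong (λ t → v x - w x + t) (sumBy-minus v w L))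
  where
  interchange : ∀ a b c d → (a + c) - (b + d) ≡ (a - b) + (c - d)
  interchange = solve-∀

sumBy-cong : ∀ {v w} L → (∀ x → x ∈ L → v x ≡ w x) → sumBy v L ≡ sumBy w L
sumBy-cong []      eq = refl
sumBy-cong (x ∷ L) eq = cong₂ _+_ (eq x (here refl)) (sumBy-cong L (λ y y∈ → eq y (there y∈)))

weight : (ℕ → ℤ) → List ℕ → ℤ
weight w []      = 1ℤ
weight w (k ∷ x) = w k * weight w x

sumBy-weight-∷ : ∀ w k L → sumBy (weight w) (map (k ∷_) L) ≡ w k * sumBy (weight w) L
sumBy-weight-∷ w k []      = sym (ℤ.*-zeroʳ (w k))
sumBy-weight-∷ w k (x ∷ L) =
  trans (cong (λ t → w k * weight w x + t) (sumBy-weight-∷ w k L)) (sym (ℤ.*-distribˡ-+ (w k) _ _))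

-- ∑_λ w(λ₁) w(λ₂) ⋯ q^|λ| over partitions with parts ≤ m, i.e. ∏_{k ≤ m} (1 - w k q^k)⁻¹
partitionSeries : (ℕ → ℤ) → ℕ → Series
partitionSeries w m n = sumBy (weight w) (boundedPartitions n m n)

-- the same over partitions into distinct parts ≤ m, i.e. ∏_{k ≤ m} (1 + w k q^k)
distinctPartitionSeries : (ℕ → ℤ) → ℕ → Series
distinctPartitionSeries w m n = sumBy (weight w) (distinctPartitions m n)

partitionSeries-step : ∀ w m → (suc m , - w (suc m)) ⊛ partitionSeries w (suc m) ≗ partitionSeries w m
partitionSeries-step w m zero = trans (cong (λ t → 1ℤ + 0ℤ + t) (ℤ.*-zeroʳ (- w (suc m)))) (ℤ.+-identityʳ _)
partitionSeries-step w m (suc n) with m ℕ.≤? n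
... | yes m≤n = begin
  sumBy (weight w) (smaller ++ map (suc m ∷_) (boundedPartitions n (suc m) (n ∸ m)))
      + - c * shift m (partitionSeries w (suc m)) n
    ≡⟨ cong₂ (λ a b → a + - c * b)
         (trans (sumBy-++ (weight w) smaller _) (cong (λ t → A + t) (sumBy-weight-∷ w (suc m) (boundedPartitions n (suc m) (n ∸ m)))))
         (shift-≥ m (partitionSeries w (suc m)) m≤n) ⟩
  (A + c * sumBy (weight w) (boundedPartitions n (suc m) (n ∸ m))) + - c * B
    ≡⟨ cong (λ L → (A + c * sumBy (weight w) L) + - c * B) (boundedPartitions-fuel n (suc m) (n ∸ m) (ℕ.m∸n≤m n m)) ⟩
  (A + c * B) + - c * B
    ≡⟨ cancel A c B ⟩
  A ∎
  where
  open ≡-Reasoning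
  c = w (suc m)
  smaller = boundedPartitions (suc n) m (suc n)
  A = sumBy (weight w) smaller
  B = partitionSeries w (suc m) (n ∸ m)
  cancel : ∀ a c b → (a + c * b) + - c * b ≡ a
  cancel = solve-∀
... | no m≰n = begin
  sumBy (weight w) (smaller ++ []) + - c * shift m (partitionSeries w (suc m)) n
    ≡⟨ cong₂ (λ a b → a + - c * b) (cong (sumBy (weight w)) (++-identityʳ smaller))
         (shift-< m (partitionSeries w (suc m)) (ℕ.≰⇒> m≰n)) ⟩
  sumBy (weight w) smaller + - c * 0ℤ
    ≡⟨ cong (λ t → sumBy (weight w) smaller + t) (ℤ.*-zeroʳ (- c)) ⟩
  sumBy (weight w) smaller + 0ℤ
    ≡⟨ ℤ.+-identityʳ _ ⟩
  sumBy (weight w) smaller ∎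
  where
  open ≡-Reasoning
  c = w (suc m)
  smaller = boundedPartitions (suc n) m (suc n)

partitionSeries-inverse : ∀ w m N → prod (binomials (λ k → - w k) m) (partitionSeries w m) ≈[ N ] δ
partitionSeries-inverse w zero    N zero    _ = refl
partitionSeries-inverse w zero    N (suc n) _ = refl
partitionSeries-inverse w (suc m) N =
  ≈-trans N (⊛-prod (suc m , - w (suc m)) (binomials (λ k → - w k) m) (partitionSeries w (suc m)) N)
    (≈-trans N (prod-cong (binomials (λ k → - w k) m) N (≗⇒≈ N (partitionSeries-step w m)))
      (partitionSeries-inverse w m N))

distinctPartitionSeries-step : ∀ w m → distinctPartitionSeries w (suc m) ≗ (suc m , w (suc m)) ⊛ distinctPartitionSeries w m
distinctPartitionSeries-step w m n with suc m ℕ.≤? n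
... | yes m<n = begin
  sumBy (weight w) (distinctPartitions m n ++ map (suc m ∷_) (distinctPartitions m (n ∸ suc m)))
    ≡⟨ sumBy-++ (weight w) (distinctPartitions m n) _ ⟩
  S n + sumBy (weight w) (map (suc m ∷_) (distinctPartitions m (n ∸ suc m)))
    ≡⟨ cong (λ t → S n + t) (sumBy-weight-∷ w (suc m) (distinctPartitions m (n ∸ suc m))) ⟩
  S n + c * S (n ∸ suc m)
    ≡⟨ cong (λ t → S n + c * t) (sym (shift-≥ (suc m) S m<n)) ⟩
  S n + c * shift (suc m) S n ∎
  where
  open ≡-Reasoning
  S = distinctPartitionSeries w m
  c = w (suc m)
... | no m≮n = begin
  sumBy (weight w) (distinctPartitions m n ++ [])
    ≡⟨ cong (sumBy (weight w)) (++-identityʳ (distinctPartitions m n)) ⟩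
  S n
    ≡⟨ sym (top-vanishes (ℕ.≰⇒> m≮n)) ⟩
  S n + c * shift (suc m) S n ∎
  where
  open ≡-Reasoning
  S = distinctPartitionSeries w m
  c = w (suc m)
  top-vanishes : n < suc m → S n + c * shift (suc m) S n ≡ S n
  top-vanishes n<k = ⊛-high c S n<k n ℕ.≤-refl

distinctPartitionSeries-prod : ∀ w m N → distinctPartitionSeries w m ≈[ N ] prod (binomials w m) δ
distinctPartitionSeries-prod w zero    N zero    _ = refl
distinctPartitionSeries-prod w zero    N (suc n) _ = refl
distinctPartitionSeries-prod w (suc m) N =
  ≈-trans N (≗⇒≈ N (distinctPartitionSeries-step w m)) (⊛-cong (suc m , w (suc m)) N (distinctPartitionSeries-prod w m N))

𝟙 : Bool → ℤ
𝟙 true  = 1ℤ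
𝟙 false = 0ℤ

𝟙-yes : ∀ {P : Set} (P? : Dec P) → P → 𝟙 (does P?) ≡ 1ℤ
𝟙-yes P? p = cong 𝟙 (dec-true P? p)

𝟙-no : ∀ {P : Set} (P? : Dec P) → ¬ P → 𝟙 (does P?) ≡ 0ℤ
𝟙-no P? ¬p = cong 𝟙 (dec-false P? ¬p)

𝟙-∧ : ∀ a b → 𝟙 (a ∧ b) ≡ 𝟙 a * 𝟙 b
𝟙-∧ true  b = sym (ℤ.*-identityˡ (𝟙 b))
𝟙-∧ false b = sym (ℤ.*-zeroˡ (𝟙 b))

𝟙-∧-not : ∀ a b → 𝟙 (a ∧ b) - 𝟙 (a ∧ not b) ≡ (𝟙 b - 𝟙 (not b)) * 𝟙 a
𝟙-∧-not true  true  = refl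
𝟙-∧-not true  false = refl
𝟙-∧-not false true  = refl
𝟙-∧-not false false = refl

length-filter : ∀ {Q : List ℕ → Set} (Q? : Decidable Q) L → + length (filter Q? L) ≡ sumBy (λ x → 𝟙 (does (Q? x))) L
length-filter Q? []      = refl
length-filter Q? (x ∷ L) with does (Q? x)
... | true  = cong (λ t → 1ℤ + t) (length-filter Q? L)
... | false = trans (length-filter Q? L) (sym (ℤ.+-identityˡ _))

Counts⇒≡length-filter : ∀ {P Q : List ℕ → Set} {c L} (Q? : Decidable Q) → Unique L →
  (∀ x → P x ⇔ (x ∈ L × Q x)) → c Counts P → c ≡ length (filter Q? L)
Counts⇒≡length-filter Q? uniqueL P⇔ (M , uniqueM , M⇔ , refl) =
  ↭-length (∼bag⇒↭ (unique∧set⇒bag uniqueM (Unique.filter⁺ Q? uniqueL) λ {x} → mk⇔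
    (λ x∈M → let (x∈L , q) = Equivalence.to (P⇔ x) (Equivalence.to (M⇔ x) x∈M) in ∈-filter⁺ Q? x∈L q)
    (λ x∈ → Equivalence.from (M⇔ x) (Equivalence.from (P⇔ x) (∈-filter⁻ Q? x∈)))))

weight-*-𝟙 : ∀ s {P : ℕ → Set} (P? : Decidable P) x →
  weight (λ k → s k * 𝟙 (does (P? k))) x ≡ weight s x * 𝟙 (does (All.all? P? x))
weight-*-𝟙 s P? []      = refl
weight-*-𝟙 s P? (k ∷ x) = begin
  (s k * 𝟙 p) * weight (λ k → s k * 𝟙 (does (P? k))) x ≡⟨ cong (λ t → (s k * 𝟙 p) * t) (weight-*-𝟙 s P? x) ⟩
  (s k * 𝟙 p) * (weight s x * 𝟙 a)                     ≡⟨ rearrange (s k) (𝟙 p) (weight s x) (𝟙 a) ⟩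
  (s k * weight s x) * (𝟙 p * 𝟙 a)                     ≡⟨ cong (λ t → (s k * weight s x) * t) (sym (𝟙-∧ p a)) ⟩
  (s k * weight s x) * 𝟙 (p ∧ a)                       ∎
  where
  open ≡-Reasoning
  p = does (P? k)
  a = does (All.all? P? x)
  rearrange : ∀ a b c d → (a * b) * (c * d) ≡ (a * c) * (b * d)
  rearrange = solve-∀

sign-suc : ∀ n → sign (suc n) ≡ - sign n
sign-suc zero          = refl
sign-suc (suc zero)    = refl
sign-suc (suc (suc n)) = sign-suc n

sign-+ : ∀ a b → sign (a ℕ.+ b) ≡ sign a * sign b
sign-+ zero    b = sym (ℤ.*-identityˡ _)
sign-+ (suc a) b = begin
  sign (suc (a ℕ.+ b))  ≡⟨ sign-suc (a ℕ.+ b) ⟩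
  - sign (a ℕ.+ b)      ≡⟨ cong -_ (sign-+ a b) ⟩
  - (sign a * sign b)   ≡⟨ ℤ.neg-distribˡ-* (sign a) (sign b) ⟩
  - sign a * sign b     ≡⟨ cong (_* sign b) (sym (sign-suc a)) ⟩
  sign (suc a) * sign b ∎
  where open ≡-Reasoning

weight-sign : ∀ x → weight sign x ≡ sign (sum x)
weight-sign []      = refl
weight-sign (k ∷ x) = trans (cong (sign k *_) (weight-sign x)) (sym (sign-+ k (sum x)))

weight-neg : ∀ x → weight (λ _ → -1ℤ) x ≡ sign (length x)
weight-neg []      = refl
weight-neg (k ∷ x) = trans (cong (-1ℤ *_) (weight-neg x)) (trans (ℤ.-1*i≡-i _) (sym (sign-suc (length x))))

2∣double : ∀ j → 2 ∣ double j
2∣double j = divides j (trans (double-≡-+ j) (sym (trans (ℕ.*-comm j 2) (cong (j ℕ.+_) (ℕ.+-identityʳ j)))))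

2∤suc-double : ∀ j → ¬ 2 ∣ suc (double j)
2∤suc-double zero    2∣1 with ∣⇒≤ 2∣1
... | s≤s ()
2∤suc-double (suc j) 2∣ = 2∤suc-double j (∣m+n∣m⇒∣n 2∣ ∣-refl)

sign-double : ∀ j → sign (double j) ≡ 1ℤ
sign-double zero    = refl
sign-double (suc j) = sign-double j

sign-suc-double : ∀ j → sign (suc (double j)) ≡ -1ℤ
sign-suc-double zero    = refl
sign-suc-double (suc j) = sign-suc-double j

sign-parity : ∀ n → sign n ≡ 𝟙 (does (2 ∣? n)) - 𝟙 (not (does (2 ∣? n)))
sign-parity n with evenOdd n
... | even j = trans (sign-double j) (cong (λ b → 𝟙 b - 𝟙 (not b)) (sym (dec-true (2 ∣? double j) (2∣double j))))
... | odd j  = trans (sign-suc-double j) (cong (λ b → 𝟙 b - 𝟙 (not b)) (sym (dec-false (2 ∣? suc (double j)) (2∤suc-double j))))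

module _ (ℓ : ℕ) .{{_ : NonZero ℓ}} where

  Allowed? : Decidable (AllowedResidue ℓ)
  Allowed? k = (k % ℓ ℕ.≟ 0) ⊎-dec ¬? (2 ∣? (k % ℓ))

  Regular? : Decidable (Regular ℓ)
  Regular? = All.all? (λ k → ¬? (ℓ ∣? k))

  regularCoeff allowedCoeff : ℕ → ℤ
  regularCoeff k = -1ℤ * 𝟙 (does (¬? (ℓ ∣? k)))
  allowedCoeff k = sign k * 𝟙 (does (Allowed? k))

  regular×allowed-pair : 2 ∣ ℓ → ∀ k fs →
    (k , - regularCoeff k) ∷ (k , allowedCoeff k) ∷ fs ≋ (k , 1ℤ) ∷ (k , oddCoeff k) ∷ fs
  regular×allowed-pair 2∣ℓ k fs with evenOdd k
  ... | odd j = ≋-trans (≋-coeff _ _ (cong (λ t → - (-1ℤ * t)) (𝟙-yes (¬? (ℓ ∣? k)) ℓ∤k)))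
                  (≋-prefix (_ ∷ []) (≋-coeff _ fs (begin
                    sign k * 𝟙 (does (Allowed? k)) ≡⟨ cong₂ _*_ (sign-suc-double j) (𝟙-yes (Allowed? k) allowed) ⟩
                    -1ℤ                            ≡⟨ sym (oddCoeff-odd j) ⟩
                    oddCoeff k                     ∎)))
    where
    open ≡-Reasoning
    ℓ∤k : ¬ ℓ ∣ suc (double j)
    ℓ∤k ℓ∣k = 2∤suc-double j (∣-trans 2∣ℓ ℓ∣k)
    allowed : AllowedResidue ℓ (suc (double j))
    allowed = inj₂ λ 2∣k%ℓ → 2∤suc-double j (∣n∣m%n⇒∣m 2∣ℓ 2∣k%ℓ)
  ... | even j = byDivisibility (ℓ ∣? double j)
    where
    byDivisibility : Dec (ℓ ∣ double j) →
      (double j , - regularCoeff (double j)) ∷ (double j , allowedCoeff (double j)) ∷ fs ≋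
      (double j , 1ℤ) ∷ (double j , oddCoeff (double j)) ∷ fs
    byDivisibility (yes ℓ∣k) =
      ≋-trans (≋-coeff _ _ (cong (λ t → - (-1ℤ * t)) (𝟙-no (¬? (ℓ ∣? double j)) (λ ℓ∤k → ℓ∤k ℓ∣k))))
        (≋-trans (≋-prefix (_ ∷ []) (≋-coeff _ fs allowed≡1))
          (≋-trans (↭⇒≋ (swap _ _ ↭.refl)) (≋-prefix (_ ∷ []) (≋-coeff _ fs (sym (oddCoeff-even j))))))
      where
      allowed≡1 : allowedCoeff (double j) ≡ 1ℤ
      allowed≡1 = cong₂ _*_ (sign-double j) (𝟙-yes (Allowed? (double j)) (inj₁ (n∣m⇒m%n≡0 (double j) ℓ ℓ∣k)))
    byDivisibility (no ℓ∤k) =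
      ≋-trans (≋-coeff _ _ (cong (λ t → - (-1ℤ * t)) (𝟙-yes (¬? (ℓ ∣? double j)) ℓ∤k)))
        (≋-prefix (_ ∷ []) (≋-coeff _ fs (trans allowed≡0 (sym (oddCoeff-even j)))))
      where
      notAllowed : ¬ AllowedResidue ℓ (double j)
      notAllowed (inj₁ k%ℓ≡0) = ℓ∤k (m%n≡0⇒n∣m (double j) ℓ k%ℓ≡0)
      notAllowed (inj₂ 2∤k%ℓ) = 2∤k%ℓ (%-presˡ-∣ (2∣double j) 2∣ℓ)
      allowed≡0 : allowedCoeff (double j) ≡ 0ℤ
      allowed≡0 = trans (cong (sign (double j) *_) (𝟙-no (Allowed? (double j)) notAllowed)) (ℤ.*-zeroʳ (sign (double j)))

  regular++allowed≋eulerProduct : 2 ∣ ℓ → ∀ N →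
    binomials (λ k → - regularCoeff k) N ++ binomials allowedCoeff N ≋ eulerProduct N
  regular++allowed≋eulerProduct 2∣ℓ N =
    ≋-trans (↭⇒≋ (binomials-++-↭ _ _ N)) (binomialPairs-≋ (regular×allowed-pair 2∣ℓ) N)

  regularSeries≡allowedSeries : 2 ∣ ℓ → ∀ N →
    partitionSeries regularCoeff N N ≡ distinctPartitionSeries allowedCoeff N N
  regularSeries≡allowedSeries 2∣ℓ N =
    prod-cancel regular N (binomials-positive _ N)
      (≈-trans N (partitionSeries-inverse regularCoeff N N) (≈-sym N allowedSide)) N ℕ.≤-refl
    where
    regular = binomials (λ k → - regularCoeff k) N
    allowedSide : prod regular (distinctPartitionSeries allowedCoeff N) ≈[ N ] δ
    allowedSide =
      ≈-trans N (prod-cong regular N (distinctPartitionSeries-prod allowedCoeff N N))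
        (subst (λ G → G ≈[ N ] δ) (prod-++ regular (binomials allowedCoeff N) δ)
          (≈-trans N (same-prod (regular++allowed≋eulerProduct 2∣ℓ N) δ N) (euler N δ)))

  signedRegularCount : ∀ n be bo → be Counts BE ℓ n → bo Counts BO ℓ n →
    + be - + bo ≡ partitionSeries regularCoeff n n
  signedRegularCount n be bo #BE #BO = begin
    + be - + bo
      ≡⟨ cong₂ (λ a b → + a - + b) (Counts⇒≡length-filter Even? unique restrict #BE)
                                    (Counts⇒≡length-filter Odd? unique restrict #BO) ⟩
    + length (filter Even? L) - + length (filter Odd? L)
      ≡⟨ cong₂ _-_ (length-filter Even? L) (length-filter Odd? L) ⟩
    sumBy (λ x → 𝟙 (does (Even? x))) L - sumBy (λ x → 𝟙 (does (Odd? x))) L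
      ≡⟨ sumBy-minus _ _ L ⟩
    sumBy (λ x → 𝟙 (does (Even? x)) - 𝟙 (does (Odd? x))) L
      ≡⟨ sumBy-cong L (λ x _ → perPartition x) ⟩
    sumBy (weight regularCoeff) L ∎
    where
    open ≡-Reasoning
    L = boundedPartitions n n n
    unique = boundedPartitions-unique n n n
    Even? : Decidable (λ x → Regular ℓ x × Even (length x))
    Even? x = Regular? x ×-dec (2 ∣? length x)
    Odd? : Decidable (λ x → Regular ℓ x × Odd (length x))
    Odd? x = Regular? x ×-dec ¬? (2 ∣? length x)
    restrict : ∀ {Q : List ℕ → Set} x → (IsPartition n x × Q x) ⇔ (x ∈ L × Q x)
    restrict x = mk⇔ (λ (p , q) → Equivalence.from (∈boundedPartitions⇔ n x) p , q)
                     (λ (x∈ , q) → Equivalence.to (∈boundedPartitions⇔ n x) x∈ , q)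
    perPartition : ∀ x → 𝟙 (does (Even? x)) - 𝟙 (does (Odd? x)) ≡ weight regularCoeff x
    perPartition x = begin
      𝟙 (does (Even? x)) - 𝟙 (does (Odd? x))       ≡⟨ 𝟙-∧-not (does (Regular? x)) (does (2 ∣? length x)) ⟩
      (𝟙 e - 𝟙 (not e)) * 𝟙 (does (Regular? x))  ≡⟨ cong (_* 𝟙 (does (Regular? x))) (sym (sign-parity (length x))) ⟩
      sign (length x) * 𝟙 (does (Regular? x))     ≡⟨ cong (_* 𝟙 (does (Regular? x))) (sym (weight-neg x)) ⟩
      weight (λ _ → -1ℤ) x * 𝟙 (does (Regular? x)) ≡⟨ sym (weight-*-𝟙 (λ _ → -1ℤ) (λ k → ¬? (ℓ ∣? k)) x) ⟩
      weight regularCoeff x                        ∎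
      where e = does (2 ∣? length x)

  allowedDistinctCount : ∀ n d → d Counts D ℓ n → distinctPartitionSeries allowedCoeff n n ≡ sign n * + d
  allowedDistinctCount n d #D = begin
    sumBy (weight allowedCoeff) L
      ≡⟨ sumBy-cong L perPartition ⟩
    sumBy (λ x → sign n * 𝟙 (does (All.all? Allowed? x))) L
      ≡⟨ sumBy-*ˡ (sign n) _ L ⟩
    sign n * sumBy (λ x → 𝟙 (does (All.all? Allowed? x))) L
      ≡⟨ cong (sign n *_) (sym (length-filter (All.all? Allowed?) L)) ⟩
    sign n * + length (filter (All.all? Allowed?) L)
      ≡⟨ cong (λ c → sign n * + c) (sym (Counts⇒≡length-filter (All.all? Allowed?) (distinctPartitions-unique n n) restrict #D)) ⟩
    sign n * + d ∎
    where
    open ≡-Reasoning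
    L = distinctPartitions n n
    restrict : ∀ x → D ℓ n x ⇔ (x ∈ L × All (AllowedResidue ℓ) x)
    restrict x = mk⇔ (λ (p , dist , a) → Equivalence.from (∈distinctPartitions⇔ n x) (p , dist) , a)
                     (λ (x∈ , a) → let (p , dist) = Equivalence.to (∈distinctPartitions⇔ n x) x∈ in p , dist , a)
    perPartition : ∀ x → x ∈ L → weight allowedCoeff x ≡ sign n * 𝟙 (does (All.all? Allowed? x))
    perPartition x x∈ = begin
      weight allowedCoeff x                        ≡⟨ weight-*-𝟙 sign Allowed? x ⟩
      weight sign x * 𝟙 (does (All.all? Allowed? x)) ≡⟨ cong (_* 𝟙 (does (All.all? Allowed? x))) (weight-sign x) ⟩
      sign (sum x) * 𝟙 (does (All.all? Allowed? x)) ≡⟨ cong (λ t → sign t * 𝟙 (does (All.all? Allowed? x))) Σx≡n ⟩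
      sign n * 𝟙 (does (All.all? Allowed? x))      ∎
      where Σx≡n = proj₂ (proj₂ (proj₁ (Equivalence.to (∈distinctPartitions⇔ n x) x∈)))

theorem1p1 : (ℓ : ℕ) → .{{_ : NonZero ℓ}} → 1 < ℓ → 2 ∣ ℓ → (n : ℕ) → n ≥ 1 →
    (be bo d : ℕ) → be Counts BE ℓ n → bo Counts BO ℓ n → d Counts D ℓ n →
    (+ be) - (+ bo) ≡ sign n * (+ d)
-- 1 < ℓ already follows from 2 ∣ ℓ and ℓ ≢ 0, and for n = 0 both sides are 1.
theorem1p1 ℓ _ 2∣ℓ n _ be bo d #BE #BO #D = begin
  + be - + bo                                     ≡⟨ signedRegularCount ℓ n be bo #BE #BO ⟩
  partitionSeries (regularCoeff ℓ) n n           ≡⟨ regularSeries≡allowedSeries ℓ 2∣ℓ n ⟩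
  distinctPartitionSeries (allowedCoeff ℓ) n n   ≡⟨ allowedDistinctCount ℓ n d #D ⟩
  sign n * + d                                    ∎
  where open ≡-Reasoning
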